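{- Let $\ell\ge1$ and $t\ge0$ be integers, let $H$ be a graph that is edge-maximal with respect to a rooted tree decomposition $\mathcal{T}=(B_x:x\in V(T))$ of width at most $t$, and let $\hat H$ be a $(\mathcal{T},\ell)$-skeleton of $H$. Let $w_0,\ldots,w_q$ be an induced path in $H$ of length $q\le\ell$ with $\{w_0,w_q\}\subseteq V(\hat H)$. Then $\{w_1,\ldots,w_{q-1}\}\subseteq V(\hat H)$.
   Context: A tree decomposition $(B_x:x\in V(T))$ of $H$ has bags $B_x\subseteq V(H)$ indexed by nodes of a tree $T$ such that each vertex's bags form a connected subtree and each edge lies in some bag; width is $\max_x|B_x|-1$; rooted means $T$ has a designated root. $H$ is edge-maximal with respect to it if each bag induces a clique. A node of the rooted tree $T$ is branching if it has at least two children; $\Lambda(T)$ is the set of branching nodes. For branching nodes $x,y$ such that the $x$–$y$ path $P_T(x,y)$ in $T$ has no branching node in its interior, let $G_{xy}=H[\bigcup_{z\in V(P_T(x,y))}B_z]$ with path decomposition $\mathcal{P}_{xy}=(B_z:z\in V(P_T(x,y)))$, and let $U_{xy}\subseteq V(G_{xy})$ be a set such that: (Z1) $U_{xy}$ contains the bags of both end nodes $x$ and $y$; (Z2) $|U_{xy}|\le C_t\ell^t$ for a constant $C_t$ depending only on $t$; (Z3) every non-trivial induced path $w_0,\ldots,w_q$ in $G_{xy}$ with $q\le\ell$ and $\{w_0,w_q\}\subseteq U_{xy}$ has $\{w_1,\ldots,w_{q-1}\}\subseteq U_{xy}$. A $(\mathcal{T},\ell)$-skeleton $\hat H$ of $H$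 is the induced subgraph of $H$ on the vertex set $\bigcup_{x\in\Lambda(T)}B_x\cup\bigcup_{x,y}U_{xy}$, the second union over all such pairs $x,y$ of branching nodes. -}

module Defs where

open import Data.Nat using (ℕ; zero; suc; _*_; _^_; _≤_; _<_)
open import Data.Fin using (Fin; toℕ; fromℕ; inject₁) renaming (zero to fzero; suc to fsuc)
open import Data.Fin.Subset using (Subset; _∈_; _⊆_; ∣_∣)
open import Data.Product using (Σ; ∃; _×_; _,_)
open import Data.Sum using (_⊎_)
open import Relation.Binary.PropositionalEquality using (_≡_; _≢_)
open import Relation.Nullary using (¬_)
open import Function.Definitions using (Injective)

record Graph (n : ℕ) : Set₁ where
  field
    Adj    : Fin n → Fin n → Set
    sym    : ∀ {u v} → Adj u v → Adj v u
    irrefl : ∀ {v} → ¬ Adj v v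
open Graph public

record Path {A : Set} (R : A → A → Set) (k : ℕ) : Set where
  field
    vtx     : Fin (suc k) → A
    distinct : Injective _≡_ _≡_ vtx
    step    : ∀ (i : Fin k) → R (vtx (inject₁ i)) (vtx (fsuc i))
open Path public

start : ∀ {A : Set} {R : A → A → Set} {k} → Path R k → A
start p = vtx p fzero

end : ∀ {A : Set} {R : A → A → Set} {k} → Path R k → A
end {k = k} p = vtx p (fromℕ k)

Interior : ∀ {k} → Fin (suc k) → Set
Interior {k} i = 0 < toℕ i × toℕ i < k

record InducedPath {n} (H : Graph n) (q : ℕ) : Set where
  field
    path    : Path (Adj H) q
    induced : ∀ (i j : Fin (suc q)) → suc (toℕ i) < toℕ j →
              ¬ Adj H (vtx path i) (vtx path j)
open InducedPath public

iter : ∀ {A : Set} → (A → A) → ℕ → A → A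
iter f zero    a = a
iter f (suc k) a = f (iter f k a)

record RootedTree (m : ℕ) : Set where
  field
    root        : Fin m
    parent      : Fin m → Fin m
    parent-root : parent root ≡ root
    only-root   : ∀ x → parent x ≡ x → x ≡ root
    reaches     : ∀ x → ∃ λ k → iter parent k x ≡ root
open RootedTree public

TAdj : ∀ {m} → RootedTree m → Fin m → Fin m → Set
TAdj T x y = x ≢ y × (parent T x ≡ y ⊎ parent T y ≡ x)

Child : ∀ {m} → RootedTree m → Fin m → Fin m → Set
Child T y x = y ≢ x × parent T y ≡ x

Branching : ∀ {m} → RootedTree m → Fin m → Set
Branching T x = Σ _ λ y → Σ _ λ z → y ≢ z × Child T y x × Child T z x

TPathFromTo : ∀ {m} (T : RootedTree m) → Fin m → Fin m → ℕ → Set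
TPathFromTo T x y k = Σ (Path (TAdj T) k) λ p → start p ≡ x × end p ≡ y

record TreeDecomposition {n} (H : Graph n) (m : ℕ) : Set₁ where
  field
    tree      : RootedTree m
    bag       : Fin m → Subset n
    covers    : ∀ v → ∃ λ x → v ∈ bag x
    connected : ∀ v x y k → v ∈ bag x → v ∈ bag y →
                (P : TPathFromTo tree x y k) →
                ∀ i → v ∈ bag (vtx (Σ.proj₁ P) i)
    edges     : ∀ u v → Adj H u v → ∃ λ x → u ∈ bag x × v ∈ bag x
open TreeDecomposition public

WidthAtMost : ∀ {n m} {H : Graph n} → TreeDecomposition H m → ℕ → Set
WidthAtMost 𝒯 t = ∀ x → ∣ bag 𝒯 x ∣ ≤ suc t

EdgeMaximal : ∀ {n m} (H : Graph n) → TreeDecomposition H m → Set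
EdgeMaximal H 𝒯 = ∀ x u v → u ∈ bag 𝒯 x → v ∈ bag 𝒯 x → u ≢ v → Adj H u v

module _ {n m} {H : Graph n} (𝒯 : TreeDecomposition H m) where

  private T = tree 𝒯

  GoodPath : Fin m → Fin m → ℕ → Set
  GoodPath x y k = Σ (TPathFromTo T x y k) λ P →
    Branching T x × Branching T y ×
    (∀ i → Interior i → ¬ Branching T (vtx (Σ.proj₁ P) i))

  InGxy : ∀ {x y k} → TPathFromTo T x y k → Fin n → Set
  InGxy P v = ∃ λ i → v ∈ bag 𝒯 (vtx (Σ.proj₁ P) i)

  -- (Z1)-(Z3) for U with respect to the path P (C is the constant C_t)
  ValidU : (C : ℕ → ℕ) (t ℓ : ℕ) → ∀ {x y k} → TPathFromTo T x y k → Subset n → Set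
  ValidU C t ℓ {x} {y} P U =
      (∀ v → v ∈ U → InGxy P v)
    × bag 𝒯 x ⊆ U × bag 𝒯 y ⊆ U
    × ∣ U ∣ ≤ C t * ℓ ^ t
    × (∀ q → 1 ≤ q → q ≤ ℓ → (w : InducedPath H q) →
         (∀ i → InGxy P (vtx (path w) i)) →
         start (path w) ∈ U → end (path w) ∈ U →
         ∀ i → Interior i → vtx (path w) i ∈ U)

  IsSkeleton : (C : ℕ → ℕ) (t ℓ : ℕ) → Subset n → Set
  IsSkeleton C t ℓ S = Σ (Fin m → Fin m → Subset n) λ U →
      (∀ x y → U x y ≡ U y x)
    × (∀ x y k (G : GoodPath x y k) → ValidU C t ℓ (Σ.proj₁ G) (U x y))
    × (∀ v → v ∈ S →
         (∃ λ x → Branching T x × v ∈ bag 𝒯 x)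
         ⊎ (Σ _ λ x → Σ _ λ y → Σ ℕ λ k → GoodPath x y k × v ∈ U x y))
    × (∀ v → ((∃ λ x → Branching T x × v ∈ bag 𝒯 x)
         ⊎ (Σ _ λ x → Σ _ λ y → Σ ℕ λ k → GoodPath x y k × v ∈ U x y))
         → v ∈ S)

-- Otherwise some inner w_i ∉ S lies in a maximal gap: w_a, w_b ∈ S
-- with a < i < b and no w_j ∈ S for a < j < b.  The edge w_a w_{a+1} lies in a
-- bag z₀, and z₀ is not branching (its bag would lie in S).  The non-branching
-- nodes around z₀ form a segment of T, bounded by the parent of its top τ and
-- a lower end y, both branching.  By connectivity of the decomposition, a
-- vertex in a segment bag and in another bag lies in a boundary bag unless the
-- other node is on the segment; since boundary bags lie in S, all of
-- w_a, …, w_b lie in segment bags.  A skeleton vertex in a segment bag lies in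
-- a boundary bag or in U_{y, parent τ} (a path x … y of branching nodes meeting
-- the segment is the segment's own path).  If w_a, w_b share a boundary bag,
-- edge-maximality makes them adjacent, contradicting inducedness (a + 1 < b).
-- Otherwise both lie in U_{y, parent τ}, and (Z3) puts w_{a+1} into U ⊆ S.

module Submission where

open import Defs hiding (sym)
open import Data.Nat using (ℕ; zero; suc; z<s; _+_; _*_; _∸_; _≤_; _<_; z≤n; s≤s; _≤?_; _<?_)
open import Data.Nat.Properties
open import Data.Fin using (Fin; toℕ; fromℕ; fromℕ<; inject₁) renaming (suc to fsuc)
import Data.Fin.Properties as Fin
open import Data.Fin.Subset using (Subset; _∈_)
open import Data.Fin.Subset.Properties using (_∈?_)
open import Data.Product using (Σ; ∃; _×_; _,_; proj₁; proj₂)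
open import Data.Sum using (_⊎_; inj₁; inj₂)
open import Data.Empty using (⊥; ⊥-elim)
open import Relation.Nullary using (¬_; Dec; yes; no)
open import Relation.Nullary.Decidable using (_×-dec_; _⊎-dec_; ¬?)
open import Relation.Binary.PropositionalEquality
open import Relation.Binary.Definitions using (tri<; tri≈; tri>)

-- Reading a natural number j as the position j on a path of length k
-- (positions beyond k are sent to k).
position : ∀ {k} → ℕ → Fin (suc k)
position {k} j with j <? suc k
... | yes j<1+k = fromℕ< j<1+k
... | no  _     = fromℕ k

toℕ-position : ∀ {k} j → j ≤ k → toℕ (position {k} j) ≡ j
toℕ-position {k} j j≤k with j <? suc k
... | yes j<1+k = Fin.toℕ-fromℕ< j<1+k
... | no  j≮1+k = ⊥-elim (j≮1+k (s≤s j≤k))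

position-toℕ : ∀ {k j} (i : Fin (suc k)) → toℕ i ≡ j → position j ≡ i
position-toℕ i refl = Fin.toℕ-injective (toℕ-position (toℕ i) (Fin.toℕ≤pred[n] i))

pathFromℕ : ∀ {A : Set} {R : A → A → Set} k (f : ℕ → A) →
  (∀ i j → i ≤ k → j ≤ k → f i ≡ f j → i ≡ j) →
  (∀ j → j < k → R (f j) (f (suc j))) → Path R k
pathFromℕ {R = R} k f injective related = record
  { vtx      = λ i → f (toℕ i)
  ; distinct = λ {i} {j} eq → Fin.toℕ-injective
      (injective (toℕ i) (toℕ j) (Fin.toℕ≤pred[n] i) (Fin.toℕ≤pred[n] j) eq)
  ; step     = λ i → subst (λ j → R (f j) (f (suc (toℕ i))))
      (sym (Fin.toℕ-inject₁ i)) (related (toℕ i) (Fin.toℕ<n i))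
  }

module PathByℕ {A : Set} {R : A → A → Set} {k} (P : Path R k) where

  at : ℕ → A
  at j = vtx P (position j)

  at-toℕ : ∀ i → at (toℕ i) ≡ vtx P i
  at-toℕ i = cong (vtx P) (position-toℕ i refl)

  at-end : at k ≡ end P
  at-end = cong (vtx P) (position-toℕ (fromℕ k) (Fin.toℕ-fromℕ k))

  at-step : ∀ j → j < k → R (at j) (at (suc j))
  at-step j j<k = subst₂ R (cong (vtx P) (sym (position-toℕ (inject₁ i) toℕ-i)))
                           (cong (vtx P) (sym (position-toℕ (fsuc i) (cong suc (Fin.toℕ-fromℕ< j<k)))))
                           (step P i)
    where
    i = fromℕ< j<k
    toℕ-i : toℕ (inject₁ i) ≡ j
    toℕ-i = trans (Fin.toℕ-inject₁ i) (Fin.toℕ-fromℕ< j<k)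

  at-injective : ∀ i j → i ≤ k → j ≤ k → at i ≡ at j → i ≡ j
  at-injective i j i≤k j≤k eq = begin
    i                 ≡⟨ sym (toℕ-position i i≤k) ⟩
    toℕ (position i)  ≡⟨ cong toℕ (distinct P eq) ⟩
    toℕ (position j)  ≡⟨ toℕ-position j j≤k ⟩
    j                 ∎
    where open ≡-Reasoning

module InducedByℕ {n} {H : Graph n} {q} (w : InducedPath H q) where
  open PathByℕ (path w) public

  at-induced : ∀ i j → j ≤ q → suc i < j → ¬ Adj H (at i) (at j)
  at-induced i j j≤q 1+i<j = induced w (position i) (position j)
    (subst₂ (λ a b → suc a < b) (sym (toℕ-position i i≤q)) (sym (toℕ-position j j≤q)) 1+i<j)
    where i≤q = ≤-trans (≤-trans (n≤1+n i) (<⇒≤ 1+i<j)) j≤q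

  step-after : ∀ a j → a + j < q → Adj H (at (a + j)) (at (a + suc j))
  step-after a j a+j<q = subst (λ x → Adj H (at (a + j)) (at x)) (sym (+-suc a j)) (at-step (a + j) a+j<q)

  slice : ∀ a L → a + L ≤ q → InducedPath H L
  slice a L a+L≤q = record { path = pathFromℕ L (λ j → at (a + j)) injective related ; induced = induced′ }
    where
    inside : ∀ {j} → j ≤ L → a + j ≤ q
    inside j≤L = ≤-trans (+-monoʳ-≤ a j≤L) a+L≤q
    injective : ∀ i j → i ≤ L → j ≤ L → at (a + i) ≡ at (a + j) → i ≡ j
    injective i j i≤L j≤L eq = +-cancelˡ-≡ a i j (at-injective (a + i) (a + j) (inside i≤L) (inside j≤L) eq)
    related : ∀ j → j < L → Adj H (at (a + j)) (at (a + suc j))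
    related j j<L = step-after a j (<-≤-trans (+-monoʳ-< a j<L) a+L≤q)
    induced′ : ∀ i j → suc (toℕ i) < toℕ j → ¬ Adj H (at (a + toℕ i)) (at (a + toℕ j))
    induced′ i j 1+i<j = at-induced (a + toℕ i) (a + toℕ j) (inside (Fin.toℕ≤pred[n] j))
                           (subst (_< a + toℕ j) (+-suc a (toℕ i)) (+-monoʳ-< a 1+i<j))

module Witnesses {p} (P : ℕ → Set p) (P? : ∀ d → Dec (P d)) where

  Least : ℕ → Set p
  Least d = P d × (∀ d′ → d′ < d → ¬ P d′)

  private
    leastUpTo : ∀ N → (Σ ℕ λ d → d ≤ N × Least d) ⊎ (∀ d → d ≤ N → ¬ P d)
    leastUpTo zero with P? 0
    ... | yes p0 = inj₁ (0 , z≤n , p0 , λ _ ())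
    ... | no ¬p0 = inj₂ λ { zero _ → ¬p0 }
    leastUpTo (suc N) with leastUpTo N
    ... | inj₁ (d , d≤N , least) = inj₁ (d , m≤n⇒m≤1+n d≤N , least)
    ... | inj₂ none with P? (suc N)
    ...   | yes pN = inj₁ (suc N , ≤-refl , pN , λ d d<1+N → none d (≤-pred d<1+N))
    ...   | no ¬pN = inj₂ noneUpTo1+N
      where
      noneUpTo1+N : ∀ d → d ≤ suc N → ¬ P d
      noneUpTo1+N d d≤1+N with m≤n⇒m<n∨m≡n d≤1+N
      ... | inj₁ d<1+N = none d (≤-pred d<1+N)
      ... | inj₂ refl  = ¬pN

  least : ∀ N → P N → Σ ℕ λ d → d ≤ N × Least d
  least N pN with leastUpTo N
  ... | inj₁ found = found
  ... | inj₂ none  = ⊥-elim (none N ≤-refl pN)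

  greatest : P 0 → ∀ i → Σ ℕ λ a → a ≤ i × P a × (∀ j → a < j → j ≤ i → ¬ P j)
  greatest p0 zero = 0 , z≤n , p0 , λ j 0<j j≤0 → ⊥-elim (<⇒≱ 0<j j≤0)
  greatest p0 (suc i) with P? (suc i)
  ... | yes p = suc i , ≤-refl , p , λ j i<j j≤i → ⊥-elim (<⇒≱ i<j j≤i)
  ... | no ¬p with greatest p0 i
  ...   | a , a≤i , pa , none = a , m≤n⇒m≤1+n a≤i , pa , beyond
    where
    beyond : ∀ j → a < j → j ≤ suc i → ¬ P j
    beyond j a<j j≤1+i with m≤n⇒m<n∨m≡n j≤1+i
    ... | inj₁ j<1+i = none j a<j (≤-pred j<1+i)
    ... | inj₂ refl  = ¬p

gap : ∀ {p} (P : ℕ → Set p) (P? : ∀ d → Dec (P d)) → P 0 → ∀ {i q} → ¬ P i → i ≤ q → P q →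
      Σ ℕ λ a → Σ ℕ λ b → a < i × i < b × b ≤ q × P a × P b × (∀ j → a < j → j < b → ¬ P j)
gap P P? p0 {i} {q} ¬pi i≤q pq
  with Witnesses.greatest P P? p0 i | Witnesses.least (λ d → i ≤ d × P d) (λ d → (i ≤? d) ×-dec P? d) q (i≤q , pq)
... | a , a≤i , pa , noneAbove | b , b≤q , (i≤b , pb) , noneBelow =
  a , b , ≤∧≢⇒< a≤i (λ { refl → ¬pi pa }) , ≤∧≢⇒< i≤b (λ { refl → ¬pi pb }) , b≤q , pa , pb , between
  where
  between : ∀ j → a < j → j < b → ¬ P j
  between j a<j j<b pj with j ≤? i
  ... | yes j≤i = noneAbove j a<j j≤i pj
  ... | no  j≰i = noneBelow j j<b (<⇒≤ (≰⇒> j≰i) , pj)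

module Ancestry {m} (T : RootedTree m) where

  -- anc k u is the k-th ancestor of u (the root is its own parent)
  anc : ℕ → Fin m → Fin m
  anc = iter (parent T)

  anc-+ : ∀ j k u → anc (j + k) u ≡ anc j (anc k u)
  anc-+ zero    k u = refl
  anc-+ (suc j) k u = cong (parent T) (anc-+ j k u)

  anc-suc : ∀ k u → anc (suc k) u ≡ anc k (parent T u)
  anc-suc zero    u = refl
  anc-suc (suc k) u = cong (parent T) (anc-suc k u)

  anc-root : ∀ k → anc k (root T) ≡ root T
  anc-root zero    = refl
  anc-root (suc k) = trans (cong (parent T) (anc-root k)) (parent-root T)

  anc-beyond : ∀ {K j u} → anc K u ≡ root T → K ≤ j → anc j u ≡ root T
  anc-beyond {K} {j} {u} reached K≤j = begin
    anc j u                ≡⟨ cong (λ i → anc i u) (sym (m∸n+n≡m K≤j)) ⟩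
    anc (j ∸ K + K) u      ≡⟨ anc-+ (j ∸ K) K u ⟩
    anc (j ∸ K) (anc K u)  ≡⟨ cong (anc (j ∸ K)) reached ⟩
    anc (j ∸ K) (root T)   ≡⟨ anc-root (j ∸ K) ⟩
    root T                 ∎
    where open ≡-Reasoning

  -- A node on a cycle of the parent map is the root: iterating the cycle
  -- returns to the node, but iterating long enough reaches the root.
  cycle⇒root : ∀ d c → anc (suc d) c ≡ c → c ≡ root T
  cycle⇒root d c cycle = trans (sym (periodic K)) (anc-beyond reached (m≤m*n K (suc d)))
    where
    K = proj₁ (reaches T c)
    reached = proj₂ (reaches T c)
    periodic : ∀ t → anc (t * suc d) c ≡ c
    periodic zero    = refl
    periodic (suc t) = trans (anc-+ (suc d) (t * suc d) c) (trans (cong (anc (suc d)) (periodic t)) cycle)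

  -- only the root is its own parent, so other nodes are adjacent to their parent
  parent-≢ : ∀ {x} → x ≢ root T → x ≢ parent T x
  parent-≢ x≢r x≡px = x≢r (only-root T _ (sym x≡px))

  up-edge : ∀ {x} → x ≢ root T → TAdj T x (parent T x)
  up-edge x≢r = parent-≢ x≢r , inj₁ refl

  TAdj-sym : ∀ {x y} → TAdj T x y → TAdj T y x
  TAdj-sym (x≢y , inj₁ px≡y) = (λ y≡x → x≢y (sym y≡x)) , inj₂ px≡y
  TAdj-sym (x≢y , inj₂ py≡x) = (λ y≡x → x≢y (sym y≡x)) , inj₁ py≡x

  no-return : ∀ {u k i j} → (∀ s → s < k → anc s u ≢ root T) → i < j → j ≤ k → anc i u ≢ anc j u
  no-return {u} {k} {i} {j} below i<j j≤k eq =
    below i (<-≤-trans i<j j≤k) (cycle⇒root d (anc i u) (sym (trans eq revisit)))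
    where
    d = j ∸ suc i
    revisit : anc j u ≡ anc (suc d) (anc i u)
    revisit = trans (cong (λ x → anc x u) (sym (trans (sym (+-suc d i)) (m∸n+n≡m i<j)))) (anc-+ (suc d) i u)

  anc-injective : ∀ {u k} → (∀ s → s < k → anc s u ≢ root T) →
                  ∀ i j → i ≤ k → j ≤ k → anc i u ≡ anc j u → i ≡ j
  anc-injective below i j i≤k j≤k eq with <-cmp i j
  ... | tri≈ _ i≡j _ = i≡j
  ... | tri< i<j _ _ = ⊥-elim (no-return below i<j j≤k eq)
  ... | tri> _ _ j<i = ⊥-elim (no-return below j<i i≤k (sym eq))

  child? : ∀ y x → Dec (Child T y x)
  child? y x = ¬? (y Fin.≟ x) ×-dec (parent T y Fin.≟ x)

  branching? : ∀ x → Dec (Branching T x)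
  branching? x = Fin.any? λ y → Fin.any? λ z → ¬? (y Fin.≟ z) ×-dec child? y x ×-dec child? z x

  unique-child : ∀ {x y z} → ¬ Branching T x → Child T y x → Child T z x → y ≡ z
  unique-child {y = y} {z} nb cy cz with y Fin.≟ z
  ... | yes y≡z = y≡z
  ... | no  y≢z = ⊥-elim (nb (y , z , y≢z , cy , cz))

  record Meeting (u₁ u₂ : Fin m) : Set where
    field
      d₁ d₂  : ℕ
      meet   : anc d₁ u₁ ≡ anc d₂ u₂
      below₁ : ∀ s → s < d₁ → anc s u₁ ≢ root T
      below₂ : ∀ s → s < d₂ → anc s u₂ ≢ root T
      apart  : ∀ i j → i < d₁ → anc i u₁ ≢ anc j u₂

  -- Any two nodes meet: d₁ is least with anc d₁ u₁ an ancestor of u₂, and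
  -- d₂ is least with anc d₂ u₂ equal to it.
  meeting : ∀ u₁ u₂ → Meeting u₁ u₂
  meeting u₁ u₂ = record
    { d₁ = d₁ ; d₂ = d₂ ; meet = sym meet₂ ; below₁ = below₁ ; below₂ = below₂ ; apart = apart }
    where
    K₁ = proj₁ (reaches T u₁)
    K₂ = proj₁ (reaches T u₂)
    reached₂ = proj₂ (reaches T u₂)

    -- ancestors of u₂, with a bounded (hence decidable) witness
    Above₂ : Fin m → Set
    Above₂ a = Σ (Fin (suc K₂)) λ j → anc (toℕ j) u₂ ≡ a

    above₂ : ∀ j {a} → anc j u₂ ≡ a → Above₂ a
    above₂ j e with j ≤? K₂
    ... | yes j≤K₂ = fromℕ< (s≤s j≤K₂) , trans (cong (λ i → anc i u₂) (Fin.toℕ-fromℕ< (s≤s j≤K₂))) e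
    ... | no  j≰K₂ = fromℕ K₂ , trans (cong (λ i → anc i u₂) (Fin.toℕ-fromℕ K₂))
                        (trans reached₂ (trans (sym (anc-beyond reached₂ (<⇒≤ (≰⇒> j≰K₂)))) e))

    root-above₂ : Above₂ (root T)
    root-above₂ = above₂ K₂ reached₂

    first₁ = Witnesses.least (λ d → Above₂ (anc d u₁)) (λ d → Fin.any? λ j → anc (toℕ j) u₂ Fin.≟ anc d u₁)
               K₁ (subst Above₂ (sym (proj₂ (reaches T u₁))) root-above₂)
    d₁ = proj₁ first₁
    meets₁ = proj₁ (proj₂ (proj₂ first₁))
    minimal₁ = proj₂ (proj₂ (proj₂ first₁))

    first₂ = Witnesses.least (λ d → anc d u₂ ≡ anc d₁ u₁) (λ d → anc d u₂ Fin.≟ anc d₁ u₁)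
               (toℕ (proj₁ meets₁)) (proj₂ meets₁)
    d₂ = proj₁ first₂
    meet₂ : anc d₂ u₂ ≡ anc d₁ u₁
    meet₂ = proj₁ (proj₂ (proj₂ first₂))
    minimal₂ = proj₂ (proj₂ (proj₂ first₂))

    below₁ : ∀ s → s < d₁ → anc s u₁ ≢ root T
    below₁ s s<d₁ s-root = minimal₁ s s<d₁ (subst Above₂ (sym s-root) root-above₂)

    below₂ : ∀ s → s < d₂ → anc s u₂ ≢ root T
    below₂ s s<d₂ s-root = minimal₂ s s<d₂ (trans s-root (trans (sym (anc-beyond s-root (<⇒≤ s<d₂))) meet₂))

    apart : ∀ i j → i < d₁ → anc i u₁ ≢ anc j u₂
    apart i j i<d₁ e = minimal₁ i i<d₁ (above₂ j (sym e))

  -- The route u₁ = anc 0 u₁, …, anc d₁ u₁ = anc d₂ u₂, …, anc 0 u₂ = u₂ is the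
  -- path from u₁ to u₂ in T.
  module Route {u₁ u₂} (M : Meeting u₁ u₂) where
    open Meeting M

    stop : ℕ → Fin m
    stop i with i ≤? d₁
    ... | yes _ = anc i u₁
    ... | no  _ = anc (d₁ + d₂ ∸ i) u₂

    stop-up : ∀ i → i ≤ d₁ → stop i ≡ anc i u₁
    stop-up i i≤d₁ with i ≤? d₁
    ... | yes _    = refl
    ... | no  i≰d₁ = ⊥-elim (i≰d₁ i≤d₁)

    stop-down : ∀ t → t ≤ d₂ → stop (d₁ + t) ≡ anc (d₂ ∸ t) u₂
    stop-down zero _ = trans (cong stop (+-identityʳ d₁)) (trans (stop-up d₁ ≤-refl) meet)
    stop-down (suc t) _ with d₁ + suc t ≤? d₁
    ... | yes beyond = ⊥-elim (m+1+n≰m d₁ beyond)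
    ... | no  _      = cong (λ x → anc x u₂) ([m+n]∸[m+o]≡n∸o d₁ d₂ (suc t))

    side : ∀ i → i < d₁ ⊎ ∃ λ t → i ≡ d₁ + t
    side i with i <? d₁
    ... | yes i<d₁ = inj₁ i<d₁
    ... | no  i≮d₁ = inj₂ (i ∸ d₁ , sym (m+[n∸m]≡n (≮⇒≥ i≮d₁)))

    stop-step : ∀ i → i < d₁ + d₂ → TAdj T (stop i) (stop (suc i))
    stop-step i _ with side i
    stop-step i _ | inj₁ i<d₁ =
      subst₂ (TAdj T) (sym (stop-up i (<⇒≤ i<d₁))) (sym (stop-up (suc i) i<d₁)) (up-edge (below₁ i i<d₁))
    stop-step _ i<d | inj₂ (t , refl) =
      subst₂ (TAdj T) (sym upper) (sym lower) (TAdj-sym (up-edge (below₂ (d₂ ∸ suc t) t′<d₂′)))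
      where
      t<d₂ : t < d₂
      t<d₂ = +-cancelˡ-< d₁ t d₂ i<d
      one-less : d₂ ∸ t ≡ suc (d₂ ∸ suc t)
      one-less = +-∸-assoc 1 t<d₂
      t′<d₂′ : suc (d₂ ∸ suc t) ≤ d₂
      t′<d₂′ = subst (_≤ d₂) one-less (m∸n≤m d₂ t)
      upper : stop (d₁ + t) ≡ parent T (anc (d₂ ∸ suc t) u₂)
      upper = trans (stop-down t (<⇒≤ t<d₂)) (cong (λ x → anc x u₂) one-less)
      lower : stop (suc (d₁ + t)) ≡ anc (d₂ ∸ suc t) u₂
      lower = trans (cong stop (sym (+-suc d₁ t))) (stop-down (suc t) t<d₂)

    stop-injective : ∀ i j → i ≤ d₁ + d₂ → j ≤ d₁ + d₂ → stop i ≡ stop j → i ≡ j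
    stop-injective i j i≤ j≤ eq with side i | side j
    ... | inj₁ i<d₁ | inj₁ j<d₁ =
      anc-injective below₁ i j (<⇒≤ i<d₁) (<⇒≤ j<d₁) (trans (sym (stop-up i (<⇒≤ i<d₁))) (trans eq (stop-up j (<⇒≤ j<d₁))))
    ... | inj₁ i<d₁ | inj₂ (t , refl) =
      ⊥-elim (apart i (d₂ ∸ t) i<d₁ (trans (sym (stop-up i (<⇒≤ i<d₁))) (trans eq (stop-down t (+-cancelˡ-≤ d₁ t d₂ j≤)))))
    ... | inj₂ (t , refl) | inj₁ j<d₁ =
      ⊥-elim (apart j (d₂ ∸ t) j<d₁ (trans (sym (stop-up j (<⇒≤ j<d₁))) (trans (sym eq) (stop-down t (+-cancelˡ-≤ d₁ t d₂ i≤)))))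
    ... | inj₂ (t , refl) | inj₂ (t′ , refl) = cong (d₁ +_) (sym (∸-cancelˡ-≡ t′≤d₂ t≤d₂ (sym same)))
      where
      t≤d₂  = +-cancelˡ-≤ d₁ t d₂ i≤
      t′≤d₂ = +-cancelˡ-≤ d₁ t′ d₂ j≤
      same : d₂ ∸ t ≡ d₂ ∸ t′
      same = anc-injective below₂ (d₂ ∸ t) (d₂ ∸ t′) (m∸n≤m d₂ t) (m∸n≤m d₂ t′)
               (trans (sym (stop-down t t≤d₂)) (trans eq (stop-down t′ t′≤d₂)))

    route : TPathFromTo T u₁ u₂ (d₁ + d₂)
    route = pathFromℕ (d₁ + d₂) stop stop-injective stop-step
          , stop-up 0 z≤n
          , trans (cong stop (Fin.toℕ-fromℕ (d₁ + d₂)))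
                  (trans (stop-down d₂ ≤-refl) (cong (λ x → anc x u₂) (n∸n≡0 d₂)))

  ascent : ∀ u k {x} → anc k u ≡ x → (∀ s → s < k → anc s u ≢ root T) → TPathFromTo T u x k
  ascent u k reaches-x below =
      pathFromℕ k (λ i → anc i u) (anc-injective below) (λ j j<k → up-edge (below j j<k))
    , refl
    , trans (cong (λ i → anc i u) (Fin.toℕ-fromℕ k)) reaches-x

-- The segment of a non-branching node z₀: the chain of non-branching nodes
-- through z₀.  Upwards it ends at its top τ, whose parent is branching unless
-- τ is the root; downwards it continues through the unique child of each node
-- until a leaf or a branching child (a lower end) is reached.
module Segment {m} (T : RootedTree m) (z₀ : Fin m) (z₀-nb : ¬ Branching T z₀) where
  open Ancestry T

  Stops : ℕ → Set
  Stops e = (anc e z₀ ≡ root T) ⊎ Branching T (parent T (anc e z₀))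

  stops? : ∀ e → Dec (Stops e)
  stops? e = (anc e z₀ Fin.≟ root T) ⊎-dec branching? (parent T (anc e z₀))

  -- The top τ is the first stop of the climb.  It is kept abstract: only the
  -- properties below are used, and unfolding the search is never needed.
  abstract
    private
      climb : Σ ℕ λ e → e ≤ proj₁ (reaches T z₀) × Witnesses.Least Stops stops? e
      climb = Witnesses.least Stops stops? (proj₁ (reaches T z₀)) (inj₁ (proj₂ (reaches T z₀)))

    height₀ : ℕ
    height₀ = proj₁ climb

    τ : Fin m
    τ = anc height₀ z₀

    τ-parent-branching : τ ≢ root T → Branching T (parent T τ)
    τ-parent-branching τ≢r with proj₁ (proj₂ (proj₂ climb))
    ... | inj₁ τ≡r = ⊥-elim (τ≢r τ≡r)
    ... | inj₂ br  = br

  -- u lies on the segment, e steps below its top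
  SegmentAt : Fin m → ℕ → Set
  SegmentAt u e = anc e u ≡ τ × (∀ s → s ≤ e → ¬ Branching T (anc s u)) × (∀ s → s < e → anc s u ≢ root T)

  OnSegment : Fin m → Set
  OnSegment u = Σ ℕ (SegmentAt u)

  abstract
    z₀-on : SegmentAt z₀ height₀
    z₀-on = refl , non-branching , below-root
      where
      earlier : ∀ e → e < height₀ → ¬ Stops e
      earlier = proj₂ (proj₂ (proj₂ climb))
      non-branching : ∀ s → s ≤ height₀ → ¬ Branching T (anc s z₀)
      non-branching zero    _      = z₀-nb
      non-branching (suc s) s<h br = earlier s s<h (inj₂ br)
      below-root : ∀ s → s < height₀ → anc s z₀ ≢ root T
      below-root s s<h s-root = earlier s s<h (inj₁ s-root)

  on-nb : ∀ {u} → OnSegment u → ¬ Branching T u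
  on-nb (_ , _ , nb , _) = nb 0 z≤n

  on-up : ∀ {u e} → SegmentAt u (suc e) → SegmentAt (parent T u) e
  on-up {u} {e} (top , nb , below) =
      trans (sym (anc-suc e u)) top
    , (λ s s≤e → subst (λ x → ¬ Branching T x) (anc-suc s u) (nb (suc s) (s≤s s≤e)))
    , (λ s s<e → subst (_≢ root T) (anc-suc s u) (below (suc s) (s≤s s<e)))

  on-down : ∀ {c e} → ¬ Branching T c → c ≢ root T → SegmentAt (parent T c) e → SegmentAt c (suc e)
  on-down {c} {e} c-nb c≢r (top , nb , below) = trans (anc-suc e c) top , nb′ , below′
    where
    nb′ : ∀ s → s ≤ suc e → ¬ Branching T (anc s c)
    nb′ zero    _        = c-nb
    nb′ (suc s) s<1+e    = subst (λ x → ¬ Branching T x) (sym (anc-suc s c)) (nb s (≤-pred s<1+e))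
    below′ : ∀ s → s < suc e → anc s c ≢ root T
    below′ zero    _     = c≢r
    below′ (suc s) s<1+e = subst (_≢ root T) (sym (anc-suc s c)) (below s (≤-pred s<1+e))

  on-climb : ∀ d {u e} → SegmentAt u e → d ≤ e → SegmentAt (anc d u) (e ∸ d)
  on-climb zero    on _ = on
  on-climb (suc d) {u} {suc e} on (s≤s d≤e) =
    subst (λ x → SegmentAt x (e ∸ d)) (sym (anc-suc d u)) (on-climb d (on-up on) d≤e)

  -- There is one segment node at each height: segment nodes are non-branching.
  same-height : ∀ {a b} e → SegmentAt a e → SegmentAt b e → a ≡ b
  same-height zero    (a-top , _) (b-top , _) = trans a-top (sym b-top)
  same-height {a} {b} (suc e) a-on b-on =
    unique-child parent-nb (parent-≢ (a-below 0 z<s) , refl)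
                           ((λ b≡pa → parent-≢ (b-below 0 z<s) (trans b≡pa same-parent)) , sym same-parent)
    where
    a-below = proj₂ (proj₂ a-on)
    b-below = proj₂ (proj₂ b-on)
    same-parent : parent T a ≡ parent T b
    same-parent = same-height e (on-up a-on) (on-up b-on)
    parent-nb : ¬ Branching T (parent T a)
    parent-nb = proj₁ (proj₂ (on-up a-on)) 0 z≤n

  on-ancestor : ∀ {u₁ u₂ e₁ e₂} → SegmentAt u₁ e₁ → SegmentAt u₂ e₂ → e₁ ≤ e₂ → anc (e₂ ∸ e₁) u₂ ≡ u₁
  on-ancestor {u₂ = u₂} {e₁} {e₂} on₁ on₂ e₁≤e₂ =
    same-height e₁ (subst (SegmentAt (anc (e₂ ∸ e₁) u₂)) (m∸[m∸n]≡n e₁≤e₂) (on-climb (e₂ ∸ e₁) on₂ (m∸n≤m e₂ e₁))) on₁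

  Lower : Fin m → Set
  Lower y = Branching T y × OnSegment (parent T y)

  lower-≢-parent : ∀ {y} → Lower y → y ≢ parent T y
  lower-≢-parent (br , on) y≡py = on-nb on (subst (Branching T) y≡py br)

  lower-child : ∀ {y} → Lower y → Child T y (parent T y)
  lower-child low = lower-≢-parent low , refl

  -- No segment node lies below the parent of a lower end, since that parent
  -- has the (branching) lower end as its only child.
  lowest : ∀ {y u eu} (low : Lower y) → SegmentAt u eu → eu ≤ proj₁ (proj₂ low)
  lowest {y} {u} {eu} low@(br , ey , y-on) u-on with eu ≤? ey
  ... | yes eu≤ey = eu≤ey
  ... | no  eu≰ey = ⊥-elim (on-nb (suc ey , c-on) (subst (Branching T) y≡c br))
    where
    ey<eu = ≰⇒> eu≰ey
    c = anc (eu ∸ suc ey) u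
    c-on : SegmentAt c (suc ey)
    c-on = subst (SegmentAt c) (m∸[m∸n]≡n ey<eu) (on-climb (eu ∸ suc ey) u-on (m∸n≤m eu (suc ey)))
    same-parent : parent T c ≡ parent T y
    same-parent = same-height ey (on-up c-on) y-on
    y≡c : y ≡ c
    y≡c = unique-child (on-nb (ey , y-on)) (lower-child low)
            ((λ c≡py → parent-≢ (proj₂ (proj₂ c-on) 0 z<s) (trans c≡py (sym same-parent))) , same-parent)

  lower-unique : ∀ {y₁ y₂} → Lower y₁ → Lower y₂ → y₁ ≡ y₂
  lower-unique {y₁} {y₂} low₁@(_ , e₁ , on₁) low₂@(_ , e₂ , on₂) =
    unique-child (on-nb (e₁ , on₁)) (lower-child low₁)
      ((λ y₂≡py₁ → lower-≢-parent low₂ (trans y₂≡py₁ same-parent)) , sym same-parent)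
    where
    e₁≡e₂ = ≤-antisym (lowest low₂ on₁) (lowest low₁ on₂)
    same-parent : parent T y₁ ≡ parent T y₂
    same-parent = same-height e₁ on₁ (subst (SegmentAt _) (sym e₁≡e₂) on₂)

  lower-ancestor : ∀ {y u eu} (low : Lower y) → SegmentAt u eu →
                   Σ ℕ λ s → s ≤ suc (proj₁ (proj₂ low)) × anc s y ≡ u
  lower-ancestor {y} {u} {eu} low@(_ , ey , y-on) u-on =
    suc (ey ∸ eu) , s≤s (m∸n≤m ey eu) , trans (anc-suc (ey ∸ eu) y) (on-ancestor u-on y-on (lowest low u-on))

  Boundary : Fin m → Set
  Boundary x = (τ ≢ root T × x ≡ parent T τ) ⊎ Lower x

  boundary-branching : ∀ {x} → Boundary x → Branching T x
  boundary-branching (inj₁ (τ≢r , refl)) = τ-parent-branching τ≢r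
  boundary-branching (inj₂ (br , _))     = br

  segment-step : ∀ {u u′} → OnSegment u → TAdj T u u′ → OnSegment u′ ⊎ Boundary u′
  segment-step (zero , top , _) (u≢u′ , inj₁ refl) = inj₂ (inj₁ (τ≢r , cong (parent T) top))
    where
    τ≢r : τ ≢ root T
    τ≢r τ≡r = u≢u′ (trans u≡r (sym (trans (cong (parent T) u≡r) (parent-root T))))
      where u≡r = trans top τ≡r
  segment-step (suc e , on) (_ , inj₁ refl) = inj₁ (e , on-up on)
  segment-step {u′ = u′} (e , on) (u≢u′ , inj₂ refl) with branching? u′
  ... | yes br = inj₂ (inj₂ (br , e , on))
  ... | no  nb = inj₁ (suc e , on-down nb u′≢r on)
    where
    u′≢r : u′ ≢ root T
    u′≢r u′≡r = u≢u′ (trans (cong (parent T) u′≡r) (trans (parent-root T) (sym u′≡r)))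

  descend : ∀ d u → (∀ s → s < d → anc s u ≢ root T) → OnSegment (anc d u) →
            OnSegment u ⊎ Σ ℕ λ j → j < d × Lower (anc j u)
  descend zero    u _     on = inj₁ on
  descend (suc d) u below on
    with descend d (parent T u) (λ s s<d → subst (_≢ root T) (anc-suc s u) (below (suc s) (s≤s s<d)))
                   (subst OnSegment (anc-suc d u) on)
  ... | inj₂ (j , j<d , low) = inj₂ (suc j , s≤s j<d , subst Lower (sym (anc-suc j u)) low)
  ... | inj₁ (e , parent-on) with branching? u
  ...   | yes br = inj₂ (0 , z<s , br , e , parent-on)
  ...   | no  nb = inj₁ (suc e , on-down nb (below 0 z<s) parent-on)

  walk : ∀ (g : ℕ → Fin m) L → (∀ j → j < L → TAdj T (g j) (g (suc j))) →
         (∀ j → 0 < j → j < L → ¬ Branching T (g j)) → OnSegment (g 0) →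
         OnSegment (g L) ⊎ Boundary (g L)
  walk g zero    _     _     start = inj₁ start
  walk g (suc L) steps inner start
    with walk g L (λ j j<L → steps j (m<n⇒m<1+n j<L)) (λ j 0<j j<L → inner j 0<j (m<n⇒m<1+n j<L)) start
  ... | inj₁ on = segment-step on (steps L ≤-refl)
  ... | inj₂ bd = ⊥-elim (non-branching L ≤-refl (boundary-branching bd))
    where
    non-branching : ∀ j → j ≤ L → ¬ Branching T (g j)
    non-branching zero    _ = on-nb start
    non-branching (suc j) j<L = inner (suc j) z<s (s≤s j<L)

  Spans : Fin m → Fin m → Set
  Spans x y = τ ≢ root T × Σ (Fin m) λ y′ → Lower y′ ×
              ((x ≡ parent T τ × y ≡ y′) ⊎ (x ≡ y′ × y ≡ parent T τ))

  spanning : ∀ {x y k} (P : TPathFromTo T x y k) → Branching T x → Branching T y →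
             (∀ i → Interior i → ¬ Branching T (vtx (proj₁ P) i)) →
             ∀ i → OnSegment (vtx (proj₁ P) i) → Spans x y
  spanning {x} {y} {k} (P , start≡x , end≡y) x-br y-br interior i i-on = classify x-boundary y-boundary
    where
    open PathByℕ P
    j   = toℕ i
    j≤k = Fin.toℕ≤pred[n] i

    j-on : OnSegment (at j)
    j-on = subst OnSegment (sym (at-toℕ i)) i-on

    inner : ∀ l → 0 < l → l < k → ¬ Branching T (at l)
    inner l 0<l l<k = interior (position l) (subst (0 <_) (sym eq) 0<l , subst (_< k) (sym eq) l<k)
      where eq = toℕ-position l (<⇒≤ l<k)

    at-k≡y : at k ≡ y
    at-k≡y = trans at-end end≡y

    boundary : ∀ {z} → Branching T z → OnSegment z ⊎ Boundary z → Boundary z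
    boundary z-br (inj₁ on) = ⊥-elim (on-nb on z-br)
    boundary z-br (inj₂ bd) = bd

    forward : OnSegment (at (j + (k ∸ j))) ⊎ Boundary (at (j + (k ∸ j)))
    forward = walk (λ l → at (j + l)) (k ∸ j) moves inner′ (subst OnSegment (cong at (sym (+-identityʳ j))) j-on)
      where
      j+l<k : ∀ {l} → l < k ∸ j → j + l < k
      j+l<k {l} l<k∸j = subst (j + l <_) (m+[n∸m]≡n j≤k) (+-monoʳ-< j l<k∸j)
      moves : ∀ l → l < k ∸ j → TAdj T (at (j + l)) (at (j + suc l))
      moves l l<k∸j = subst (λ a → TAdj T (at (j + l)) (at a)) (sym (+-suc j l)) (at-step (j + l) (j+l<k l<k∸j))
      inner′ : ∀ l → 0 < l → l < k ∸ j → ¬ Branching T (at (j + l))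
      inner′ l 0<l l<k∸j = inner (j + l) (≤-trans 0<l (m≤n+m l j)) (j+l<k l<k∸j)

    backward : OnSegment (at (j ∸ j)) ⊎ Boundary (at (j ∸ j))
    backward = walk (λ l → at (j ∸ l)) j moves inner′ j-on
      where
      one-less : ∀ {l} → l < j → j ∸ l ≡ suc (j ∸ suc l)
      one-less l<j = +-∸-assoc 1 l<j
      moves : ∀ l → l < j → TAdj T (at (j ∸ l)) (at (j ∸ suc l))
      moves l l<j = TAdj-sym (subst (λ a → TAdj T (at (j ∸ suc l)) (at a)) (sym (one-less l<j))
                     (at-step (j ∸ suc l) (<-≤-trans (subst (_≤ j) (one-less l<j) (m∸n≤m j l)) j≤k)))
      inner′ : ∀ l → 0 < l → l < j → ¬ Branching T (at (j ∸ l))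
      inner′ l 0<l l<j = inner (j ∸ l) (m<n⇒0<n∸m l<j) (<-≤-trans (∸-monoʳ-< 0<l (<⇒≤ l<j)) j≤k)

    y-boundary : Boundary y
    y-boundary = subst Boundary y-at (boundary (subst (Branching T) (sym y-at) y-br) forward)
      where y-at = trans (cong at (m+[n∸m]≡n j≤k)) at-k≡y

    x-boundary : Boundary x
    x-boundary = subst Boundary x-at (boundary (subst (Branching T) (sym x-at) x-br) backward)
      where x-at = trans (cong at (n∸n≡0 j)) start≡x

    -- the ends differ: otherwise k = 0 and the segment node visited is x itself
    x≢y : x ≢ y
    x≢y x≡y = on-nb (subst OnSegment (trans (cong at j≡0) start≡x) j-on) x-br
      where
      0≡k = at-injective 0 k z≤n ≤-refl (trans start≡x (trans x≡y (sym at-k≡y)))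
      j≡0 = n≤0⇒n≡0 (subst (j ≤_) (sym 0≡k) j≤k)

    classify : Boundary x → Boundary y → Spans x y
    classify (inj₁ (_ , x≡p))    (inj₁ (_ , y≡p))    = ⊥-elim (x≢y (trans x≡p (sym y≡p)))
    classify (inj₂ x-low)        (inj₂ y-low)        = ⊥-elim (x≢y (lower-unique x-low y-low))
    classify (inj₁ (τ≢r , x≡p))  (inj₂ y-low)        = τ≢r , y , y-low , inj₁ (x≡p , refl)
    classify (inj₂ x-low)        (inj₁ (τ≢r , y≡p))  = τ≢r , x , x-low , inj₂ (refl , y≡p)

  segment-length : ∀ {y} → Lower y → ℕ
  segment-length (_ , ey , _) = suc (suc ey)

  segment-path : τ ≢ root T → ∀ {y} (low : Lower y) → TPathFromTo T y (parent T τ) (segment-length low)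
  segment-path τ≢r {y} low@(_ , ey , top , _ , below) =
    ascent y (suc (suc ey)) (cong (parent T) (trans (anc-suc ey y) top)) below′
    where
    below′ : ∀ s → s < suc (suc ey) → anc s y ≢ root T
    below′ zero _ y≡r = lower-≢-parent low (trans y≡r (sym (trans (cong (parent T) y≡r) (parent-root T))))
    below′ (suc s) s<2+ey with m≤n⇒m<n∨m≡n (≤-pred (≤-pred s<2+ey))
    ... | inj₁ s<ey = subst (_≢ root T) (sym (anc-suc s y)) (below s s<ey)
    ... | inj₂ refl = subst (_≢ root T) (sym (trans (anc-suc s y) top)) τ≢r

  segment-path-interior : (τ≢r : τ ≢ root T) → ∀ {y} (low : Lower y) →
                          ∀ i → Interior i → ¬ Branching T (vtx (proj₁ (segment-path τ≢r low)) i)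
  segment-path-interior τ≢r {y} (_ , ey , _ , nb , _) i (0<i , i<len) with toℕ i
  ... | suc s = subst (λ x → ¬ Branching T x) (sym (anc-suc s y)) (nb s (≤-pred (≤-pred i<len)))

  segment-path-covers : (τ≢r : τ ≢ root T) → ∀ {y} (low : Lower y) → ∀ {u e} → SegmentAt u e →
                        ∃ λ i → vtx (proj₁ (segment-path τ≢r low)) i ≡ u
  segment-path-covers τ≢r {y} low u-on with lower-ancestor low u-on
  ... | s , s≤1+ey , reaches-u =
    position s , trans (cong (λ j → anc j y) (toℕ-position s (m≤n⇒m≤1+n s≤1+ey))) reaches-u

module Bags {n m} {H : Graph n} (𝒯 : TreeDecomposition H m) where
  open Ancestry (tree 𝒯)

  B : Fin m → Subset n
  B = bag 𝒯

  bags-on-route : ∀ {u₁ u₂} (M : Meeting u₁ u₂) {v} → v ∈ B u₁ → v ∈ B u₂ →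
                  (∀ s → s ≤ Meeting.d₁ M → v ∈ B (anc s u₁)) × (∀ s → s ≤ Meeting.d₂ M → v ∈ B (anc s u₂))
  bags-on-route {u₁} {u₂} M {v} v∈₁ v∈₂ = ascending , descending
    where
    open Meeting M
    open Route M
    on-route : ∀ i → i ≤ d₁ + d₂ → v ∈ B (stop i)
    on-route i i≤ = subst (λ j → v ∈ B (stop j)) (toℕ-position i i≤)
                      (connected 𝒯 v u₁ u₂ (d₁ + d₂) v∈₁ v∈₂ route (position i))
    ascending : ∀ s → s ≤ d₁ → v ∈ B (anc s u₁)
    ascending s s≤d₁ = subst (v ∈_) (cong B (stop-up s s≤d₁)) (on-route s (≤-trans s≤d₁ (m≤m+n d₁ d₂)))
    descending : ∀ s → s ≤ d₂ → v ∈ B (anc s u₂)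
    descending s s≤d₂ =
      subst (v ∈_) (cong B (trans (stop-down (d₂ ∸ s) (m∸n≤m d₂ s)) (cong (λ j → anc j u₂) (m∸[m∸n]≡n s≤d₂))))
            (on-route (d₁ + (d₂ ∸ s)) (+-monoʳ-≤ d₁ (m∸n≤m d₂ s)))

  branching-bag-in-S : ∀ {C t ℓ S} → IsSkeleton 𝒯 C t ℓ S → ∀ {x v} → Branching (tree 𝒯) x → v ∈ B x → v ∈ S
  branching-bag-in-S sk {x} {v} x-br v∈x = proj₂ (proj₂ (proj₂ (proj₂ sk))) v (inj₁ (x , x-br , v∈x))

  module AroundSegment (z₀ : Fin m) (z₀-nb : ¬ Branching (tree 𝒯) z₀) where
    open Segment (tree 𝒯) z₀ z₀-nb

    BoundaryBag : Fin n → Set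
    BoundaryBag v = Σ (Fin m) λ x → Boundary x × v ∈ B x

    -- A vertex shared by a segment bag and another bag lies on the segment
    -- or in a boundary bag: the route between the two nodes leaves the
    -- segment through its boundary.
    escape : ∀ {v u₁ u₂ e} → v ∈ B u₁ → SegmentAt u₁ e → v ∈ B u₂ → OnSegment u₂ ⊎ BoundaryBag v
    escape {v} {u₁} {u₂} {e} v∈₁ u₁-on v∈₂ = leave (e <? d₁)
      where
      M = meeting u₁ u₂
      open Meeting M
      shared = bags-on-route M v∈₁ v∈₂
      top = proj₁ u₁-on
      leave : Dec (e < d₁) → OnSegment u₂ ⊎ BoundaryBag v
      -- the route climbs above τ, through its parent
      leave (yes e<d₁) = inj₂ (parent (tree 𝒯) τ , inj₁ (τ≢r , refl) ,
                               subst (λ x → v ∈ B (parent (tree 𝒯) x)) top (proj₁ shared (suc e) e<d₁))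
        where
        τ≢r : τ ≢ root (tree 𝒯)
        τ≢r τ≡r = below₁ e e<d₁ (trans top τ≡r)
      -- the route turns on the segment and descends from there to u₂
      leave (no e≮d₁) =
        descended (descend d₂ u₂ below₂ (e ∸ d₁ , subst (λ x → SegmentAt x (e ∸ d₁)) meet (on-climb d₁ u₁-on (≮⇒≥ e≮d₁))))
        where
        descended : OnSegment u₂ ⊎ Σ ℕ (λ j → j < d₂ × Lower (anc j u₂)) → OnSegment u₂ ⊎ BoundaryBag v
        descended (inj₁ u₂-on)             = inj₁ u₂-on
        descended (inj₂ (j , j<d₂ , low)) = inj₂ (anc j u₂ , inj₂ low , proj₂ shared j (<⇒≤ j<d₂))

    confined : ∀ (f : ℕ → Fin n) L → (∀ j → j < L → Adj H (f j) (f (suc j))) →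
               (∀ j → 0 < j → j < L → ¬ BoundaryBag (f j)) →
               ∀ {u₀} → OnSegment u₀ → f 0 ∈ B u₀ → f 1 ∈ B u₀ →
               ∀ s → s ≤ L → Σ (Fin m) λ u → OnSegment u × f s ∈ B u
    confined f L adjacent avoid {u₀} u₀-on f0∈ f1∈ zero          _ = u₀ , u₀-on , f0∈
    confined f L adjacent avoid {u₀} u₀-on f0∈ f1∈ (suc zero)    _ = u₀ , u₀-on , f1∈
    confined f L adjacent avoid      u₀-on f0∈ f1∈ (suc (suc s)) 2+s≤L
      with confined f L adjacent avoid u₀-on f0∈ f1∈ (suc s) (≤-trans (n≤1+n (suc s)) 2+s≤L)
    ... | u₁ , (e₁ , u₁-on) , in₁ with edges 𝒯 _ _ (adjacent (suc s) 2+s≤L)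
    ...   | u₂ , in₂ , next∈ with escape in₁ u₁-on in₂
    ...     | inj₁ u₂-on = u₂ , u₂-on , next∈
    ...     | inj₂ bb    = ⊥-elim (avoid (suc s) z<s 2+s≤L bb)

    segment-good-path : (τ≢r : τ ≢ root (tree 𝒯)) → ∀ {y} (low : Lower y) →
                        GoodPath 𝒯 y (parent (tree 𝒯) τ) (segment-length low)
    segment-good-path τ≢r low =
      segment-path τ≢r low , proj₁ low , τ-parent-branching τ≢r , segment-path-interior τ≢r low

    in-segment-G : (τ≢r : τ ≢ root (tree 𝒯)) → ∀ {y} (low : Lower y) →
                   ∀ {v u} → OnSegment u → v ∈ B u → InGxy 𝒯 (segment-path τ≢r low) v
    in-segment-G τ≢r low (_ , u-on) v∈u with segment-path-covers τ≢r low u-on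
    ... | i , reaches-u = i , subst (_ ∈_) (cong B (sym reaches-u)) v∈u

    module InSkeleton {C t ℓ S} (sk : IsSkeleton 𝒯 C t ℓ S) where
      U     = proj₁ sk
      valid = proj₁ (proj₂ (proj₂ sk))
      private
        U-sym  = proj₁ (proj₂ sk)
        from-S = proj₁ (proj₂ (proj₂ (proj₂ sk)))

      boundary-in-S : ∀ {v} → BoundaryBag v → v ∈ S
      boundary-in-S (x , bd , v∈x) = branching-bag-in-S {C = C} {t = t} {ℓ = ℓ} sk (boundary-branching bd) v∈x

      segment-U-in-S : (τ≢r : τ ≢ root (tree 𝒯)) → ∀ {y} (low : Lower y) →
                       ∀ {v} → v ∈ U y (parent (tree 𝒯) τ) → v ∈ S
      segment-U-in-S τ≢r {y} low {v} v∈U =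
        proj₂ (proj₂ (proj₂ (proj₂ sk))) v (inj₂ (y , _ , segment-length low , segment-good-path τ≢r low , v∈U))

      Anchored : Fin n → Set
      Anchored v = BoundaryBag v ⊎ (τ ≢ root (tree 𝒯) × Σ (Fin m) λ y → Lower y × v ∈ U y (parent (tree 𝒯) τ))

      -- A skeleton vertex in a segment bag is anchored: if it comes from some
      -- U x y, the path x … y visits the segment, hence is the segment's path.
      anchor : ∀ {v u e} → v ∈ S → v ∈ B u → SegmentAt u e → Anchored v
      anchor {v} v∈S v∈u u-on with from-S v v∈S
      ... | inj₁ (x , x-br , v∈x) with escape v∈u u-on v∈x
      ...   | inj₁ x-on = ⊥-elim (on-nb x-on x-br)
      ...   | inj₂ bb   = inj₁ bb
      anchor {v} v∈S v∈u u-on | inj₂ (x , y , k , G@(P , x-br , y-br , interior) , v∈U)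
        with proj₁ (valid x y k G) v v∈U
      ... | i , v∈i with escape v∈u u-on v∈i
      ...   | inj₂ bb   = inj₁ bb
      ...   | inj₁ i-on with spanning P x-br y-br interior i i-on
      ...     | τ≢r , y′ , low , inj₁ (refl , refl) = inj₂ (τ≢r , y′ , low , subst (v ∈_) (U-sym _ _) v∈U)
      ...     | τ≢r , y′ , low , inj₂ (refl , refl) = inj₂ (τ≢r , y′ , low , v∈U)

      -- By (Z1), when both boundary nodes exist every anchored vertex is in U.
      anchored-in-U : (τ≢r : τ ≢ root (tree 𝒯)) → ∀ {y} (low : Lower y) →
                      ∀ {v} → Anchored v → v ∈ U y (parent (tree 𝒯) τ)
      anchored-in-U τ≢r {y} low (inj₁ (_ , inj₁ (_ , refl) , v∈)) = upper-bag v∈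
        where upper-bag = proj₁ (proj₂ (proj₂ (valid _ _ _ (segment-good-path τ≢r low))))
      anchored-in-U τ≢r {y} low (inj₁ (_ , inj₂ low′ , v∈)) =
        lower-bag (subst (λ x → _ ∈ B x) (lower-unique low′ low) v∈)
        where lower-bag = proj₁ (proj₂ (valid _ _ _ (segment-good-path τ≢r low)))
      anchored-in-U τ≢r {y} low (inj₂ (_ , y′ , low′ , v∈U)) =
        subst (λ x → _ ∈ U x _) (lower-unique low′ low) v∈U

      SharedBag : Fin n → Fin n → Set
      SharedBag v v′ = Σ (Fin m) λ x → v ∈ B x × v′ ∈ B x

      BothEnds : Set
      BothEnds = τ ≢ root (tree 𝒯) × Σ (Fin m) Lower

      shared-or-ends : ∀ {v v′} → Anchored v → Anchored v′ → SharedBag v v′ ⊎ BothEnds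
      shared-or-ends (inj₁ (x , inj₁ (_ , refl) , v∈)) (inj₁ (_ , inj₁ (_ , refl) , v′∈)) = inj₁ (x , v∈ , v′∈)
      shared-or-ends (inj₁ (x , inj₂ low , v∈))        (inj₁ (_ , inj₂ low′ , v′∈)) =
        inj₁ (x , v∈ , subst (λ z → _ ∈ B z) (lower-unique low′ low) v′∈)
      shared-or-ends (inj₁ (_ , inj₁ (τ≢r , _) , _))   (inj₁ (x , inj₂ low , _))   = inj₂ (τ≢r , x , low)
      shared-or-ends (inj₁ (x , inj₂ low , _))         (inj₁ (_ , inj₁ (τ≢r , _) , _)) = inj₂ (τ≢r , x , low)
      shared-or-ends (inj₂ (τ≢r , y , low , _))        _                            = inj₂ (τ≢r , y , low)
      shared-or-ends (inj₁ _)                          (inj₂ (τ≢r , y , low , _))  = inj₂ (τ≢r , y , low)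

module Gap (C : ℕ → ℕ) (ℓ t : ℕ) {n m} (H : Graph n) (𝒯 : TreeDecomposition H m) (edge-maximal : EdgeMaximal H 𝒯)
           (S : Subset n) (sk : IsSkeleton 𝒯 C t ℓ S) (q : ℕ) (q≤ℓ : q ≤ ℓ) (w : InducedPath H q) where
  open InducedByℕ w
  open Bags 𝒯

  no-gap : ∀ {a b} → suc a < b → b ≤ q → at a ∈ S → at b ∈ S → (∀ j → a < j → j < b → ¬ at j ∈ S) → ⊥
  no-gap {a} {b} 1+a<b b≤q a∈S b∈S outside = conclude (shared-or-ends (anchored 0 z≤n (+-identityʳ a) a∈S)
                                                                        (anchored L ≤-refl a+L≡b b∈S))
    where
    a<b = <-trans (n<1+n a) 1+a<b

    -- the edge w_a w_{a+1} lies in a bag z₀, which is not branching as w_{a+1} ∉ S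
    first-edge = edges 𝒯 (at a) (at (suc a)) (at-step a (<-≤-trans a<b b≤q))
    z₀ = proj₁ first-edge
    z₀-nb : ¬ Branching (tree 𝒯) z₀
    z₀-nb br = outside (suc a) ≤-refl 1+a<b (branching-bag-in-S {C = C} {t = t} {ℓ = ℓ} sk br (proj₂ (proj₂ first-edge)))

    open Segment (tree 𝒯) z₀ z₀-nb
    open AroundSegment z₀ z₀-nb
    open InSkeleton {C} {t} {ℓ} {S} sk

    L = b ∸ a
    a+L≡b : a + L ≡ b
    a+L≡b = m+[n∸m]≡n (<⇒≤ a<b)
    1<L : 1 < L
    1<L = +-cancelˡ-< a 1 L (subst₂ _<_ (sym (+-comm a 1)) (sym a+L≡b) 1+a<b)

    -- all of w_a, …, w_b lie in segment bags, as the inner ones avoid S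
    segment-bags : ∀ s → s ≤ L → Σ (Fin m) λ u → OnSegment u × at (a + s) ∈ B u
    segment-bags = confined (λ j → at (a + j)) L adjacent avoid (height₀ , z₀-on)
                     (subst (λ j → at j ∈ B z₀) (sym (+-identityʳ a)) (proj₁ (proj₂ first-edge)))
                     (subst (λ j → at j ∈ B z₀) (sym (+-comm a 1)) (proj₂ (proj₂ first-edge)))
      where
      adjacent : ∀ j → j < L → Adj H (at (a + j)) (at (a + suc j))
      adjacent j j<L = step-after a j (<-≤-trans (subst (a + j <_) a+L≡b (+-monoʳ-< a j<L)) b≤q)
      avoid : ∀ j → 0 < j → j < L → ¬ BoundaryBag (at (a + j))
      avoid j 0<j j<L bb = outside (a + j) (m<m+n a 0<j) (subst (a + j <_) a+L≡b (+-monoʳ-< a j<L)) (boundary-in-S bb)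

    anchored : ∀ s {j} → s ≤ L → a + s ≡ j → at j ∈ S → Anchored (at j)
    anchored s s≤L refl j∈S = anchor j∈S (proj₂ (proj₂ bags)) (proj₂ (proj₁ (proj₂ bags)))
      where bags = segment-bags s s≤L

    conclude : SharedBag (at a) (at b) ⊎ BothEnds → ⊥
    -- w_a and w_b in a common bag would be adjacent
    conclude (inj₁ (x , a∈x , b∈x)) =
      at-induced a b b≤q 1+a<b (edge-maximal x (at a) (at b) a∈x b∈x
        (λ eq → <⇒≢ a<b (at-injective a b (<⇒≤ (<-≤-trans a<b b≤q)) b≤q eq)))
    -- otherwise w_a, …, w_b is an induced path in G_{y, parent τ} with ends in U, so by (Z3) w_{a+1} ∈ U
    conclude (inj₂ (τ≢r , y , low)) =
      outside (suc a) ≤-refl 1+a<b (segment-U-in-S τ≢r low (subst (_∈ U y (parent (tree 𝒯) τ)) (cong at second≡) second∈U))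
      where
      closed = proj₂ (proj₂ (proj₂ (proj₂ (valid _ _ _ (segment-good-path τ≢r low)))))
      σ = slice a L (subst (_≤ q) (sym a+L≡b) b≤q)
      in-U : ∀ s {j} → s ≤ L → a + s ≡ j → at j ∈ S → at (a + s) ∈ U y (parent (tree 𝒯) τ)
      in-U s s≤L refl j∈S = anchored-in-U τ≢r low (anchored s s≤L refl j∈S)
      second≡ : a + toℕ (position {L} 1) ≡ suc a
      second≡ = trans (cong (a +_) (toℕ-position 1 (<⇒≤ 1<L))) (+-comm a 1)
      second∈U : at (a + toℕ (position {L} 1)) ∈ U y (parent (tree 𝒯) τ)
      second∈U = closed L (<⇒≤ 1<L) (≤-trans (m∸n≤m b a) (≤-trans b≤q q≤ℓ)) σ
        (λ i → let (u , u-on , in-u) = segment-bags (toℕ i) (Fin.toℕ≤pred[n] i) in in-segment-G τ≢r low u-on in-u)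
        (in-U 0 z≤n (+-identityʳ a) a∈S)
        (in-U (toℕ (fromℕ L)) (≤-reflexive (Fin.toℕ-fromℕ L)) (trans (cong (a +_) (Fin.toℕ-fromℕ L)) a+L≡b) b∈S)
        (position 1)
        (subst (0 <_) (sym (toℕ-position 1 (<⇒≤ 1<L))) z<s , subst (_< L) (sym (toℕ-position 1 (<⇒≤ 1<L))) 1<L)

lemma26 : (C : ℕ → ℕ) (ℓ t : ℕ) → 1 ≤ ℓ →
    ∀ {n m} (H : Graph n) (𝒯 : TreeDecomposition H m) →
    WidthAtMost 𝒯 t → EdgeMaximal H 𝒯 →
    (S : Subset n) → IsSkeleton 𝒯 C t ℓ S →
    (q : ℕ) → q ≤ ℓ → (w : InducedPath H q) →
    start (path w) ∈ S → end (path w) ∈ S →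
    ∀ i → Interior i → vtx (path w) i ∈ S
lemma26 C ℓ t _ H 𝒯 _ edge-maximal S sk q q≤ℓ w start∈S end∈S i (_ , i<q) with vtx (path w) i ∈? S
... | yes i∈S = i∈S
... | no  i∉S =
  -- w_i ∉ S lies in a maximal gap (a , b) of S along w, which cannot exist
  let (a , b , a<i , i<b , b≤q , a∈S , b∈S , outside) =
        gap (λ j → at j ∈ S) (λ j → at j ∈? S) start∈S (λ i∈S → i∉S (subst (_∈ S) (at-toℕ i) i∈S))
            (<⇒≤ i<q) (subst (_∈ S) (sym at-end) end∈S)
  in ⊥-elim (no-gap (≤-<-trans a<i i<b) b≤q a∈S b∈S outside)
  where
  open InducedByℕ w
  open Gap C ℓ t H 𝒯 edge-maximal S sk q q≤ℓ w
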